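{- Let $\lambda$ be a partition. Then $c^\lambda_{sp}(u)\notin\{1,-1\}$ for all cells $u\in\lambda$ if and only if $\lambda=\emptyset$ or $\lambda=\delta_r=(r,r-1,\dots,2,1)$ for some positive integer $r$.
   Context: For a partition $\lambda$ with conjugate $\lambda'$ (cells $(i,j)$ = row $i$, column $j$ of the Young diagram; $\lambda_i=0$ beyond the length), the symplectic content of a cell $(i,j)\in\lambda$ is $c^\lambda_{sp}(i,j)=\lambda_i+\lambda_j-i-j+2$ if $i>j$, and $c^\lambda_{sp}(i,j)=i+j-\lambda'_i-\lambda'_j$ if $i\le j$. The staircase partition $\delta_r$ is $(r,r-1,\dots,2,1)$. -}

module Defs where

open import Data.Nat using (ℕ; zero; suc; _≤_; _<_; _≥_; _≤ᵇ_)
open import Data.Integer using (ℤ; +_; _+_; _-_)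
open import Data.List using (List; []; _∷_; length; filter)
open import Data.List.Relation.Unary.All using (All)
open import Data.List.Relation.Unary.Linked using (Linked)
open import Data.Product using (_×_)
open import Relation.Nullary.Decidable using (yes; no)
import Data.Nat as ℕ

-- With positive parts this representation is
-- canonical, so equality of partitions is propositional list equality.
IsPartition : List ℕ → Set
IsPartition l = Linked _≥_ l × All (λ x → 0 < x) l

-- λ_i with 1-based index i; λ_i = 0 beyond the length (and for i = 0).
part : List ℕ → ℕ → ℕ
part []      _             = 0
part (x ∷ l) zero          = 0
part (x ∷ l) (suc zero)    = x
part (x ∷ l) (suc (suc i)) = part l (suc i)

conj : List ℕ → ℕ → ℕ
conj []      j = 0
conj (x ∷ l) j with j ℕ.≤? x
... | yes _ = suc (conj l j)
... | no _  = conj l j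

InDiagram : List ℕ → ℕ → ℕ → Set
InDiagram l i j = 1 ≤ i × 1 ≤ j × j ≤ part l i

cSp : List ℕ → ℕ → ℕ → ℤ
cSp l i j with j ℕ.<? i
... | yes _ = (+ part l i + + part l j) - + i - + j + + 2
... | no _  = (+ i + + j) - + conj l i - + conj l j

staircase : ℕ → List ℕ
staircase zero    = []
staircase (suc r) = suc r ∷ staircase r

-- Along the staircase δ_r both λ_i + i and λ'_j + j equal r + 1, so every symplectic
-- content is a difference of two naturals with even sum, hence even.  Conversely,
-- removing the first row and column of λ leaves a partition μ whose contents are
-- those of λ shifted diagonally, so by induction μ is a staircase δ_s, and λ is δ_s
-- wrapped in a hook.  Comparing λ₁ with ℓ = λ'₁: if λ₁ < ℓ the cell (λ₁ + 1, 1) has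
-- content 1, if λ₁ > ℓ the cell (1, ℓ + 1) has content 1, and if λ₁ = ℓ a cell at the
-- end of the first row has content -1 unless λ = δ_1 or λ = δ_{s+2}.
module Submission where

open import Defs
open import Data.Nat using (ℕ; zero; suc; _+_; _≤_; _<_; _≥_; z≤n; s≤s)
open import Data.Nat.Properties
  using (≤-refl; ≤-trans; ≤-antisym; ≤-pred; <⇒≤; ≮⇒≥; <⇒≱; ≤-<-trans; m≤n⇒m≤1+n;
         m≤m+n; m<m+n; +-suc; +-comm; +-identityʳ; +-cancelʳ-≡; +-monoʳ-<; ≤-reflexive;
         even≢odd; <-cmp; <-≤-connex; m≤n⇒∃[o]m+o≡n)
import Data.Nat as ℕ
import Data.Nat.Tactic.RingSolver as ℕSolver
open import Data.Integer as ℤ using (ℤ; +_; -[1+_]; _-_)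
open import Data.Integer.Properties using (+-injective)
import Data.Integer.Tactic.RingSolver as ℤSolver
open import Data.List using (List; []; _∷_; [_]; length; map; _++_; replicate)
open import Data.List.Properties using (length-++; length-map; length-replicate)
open import Data.List.Relation.Unary.All using (All; []; _∷_)
import Data.List.Relation.Unary.All as All
open import Data.List.Relation.Unary.All.Properties using (++⁺; map⁺; replicate⁺)
import Data.List.Relation.Unary.AllPairs as AllPairs
open import Data.List.Relation.Unary.Linked using (Linked; []; [-]; _∷_)
import Data.List.Relation.Unary.Linked as Linked
open import Data.List.Relation.Unary.Linked.Properties using (Linked⇒AllPairs)
open import Data.Product using (_×_; _,_; ∃-syntax; proj₁; proj₂)
open import Data.Sum using (_⊎_; inj₁; inj₂)
open import Data.Empty using (⊥-elim)
open import Relation.Nullary using (¬_; yes; no; contradiction)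
open import Relation.Binary using (tri<; tri≈; tri>)
open import Relation.Binary.PropositionalEquality
  using (_≡_; _≢_; refl; sym; trans; cong; cong₂; subst; module ≡-Reasoning)

_≢±1 : ℤ → Set
c ≢±1 = ¬ (c ≡ + 1) × ¬ (c ≡ -[1+ 0 ])

NoContent±1 : List ℕ → Set
NoContent±1 lam = ∀ i j → InDiagram lam i j → cSp lam i j ≢±1

cSp-< : ∀ l {i j} → j < i →
        cSp l i j ≡ (((+ part l i ℤ.+ + part l j) - + i) - + j) ℤ.+ + 2
cSp-< l {i} {j} j<i with j ℕ.<? i
... | yes _  = refl
... | no j≮i = contradiction j<i j≮i

cSp-≥ : ∀ l {i j} → i ≤ j → cSp l i j ≡ ((+ i ℤ.+ + j) - + conj l i) - + conj l j
cSp-≥ l {i} {j} i≤j with j ℕ.<? i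
... | yes j<i = contradiction i≤j (<⇒≱ j<i)
... | no _    = refl

conj-∷-≤ : ∀ {x} l {j} → j ≤ x → conj (x ∷ l) j ≡ suc (conj l j)
conj-∷-≤ {x} l {j} j≤x with j ℕ.≤? x
... | yes _  = refl
... | no j≰x = contradiction j≤x j≰x

conj-∷-≰ : ∀ {x} l {j} → ¬ j ≤ x → conj (x ∷ l) j ≡ conj l j
conj-∷-≰ {x} l {j} j≰x with j ℕ.≤? x
... | yes j≤x = contradiction j≤x j≰x
... | no _    = refl

conj-All< : ∀ {l j} → All (_< j) l → conj l j ≡ 0
conj-All< {[]}    []         = refl
conj-All< {x ∷ l} (x<j ∷ ps) = trans (conj-∷-≰ l (<⇒≱ x<j)) (conj-All< ps)

conj-1 : ∀ {l} → All (0 <_) l → conj l 1 ≡ length l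
conj-1 {[]}    []         = refl
conj-1 {x ∷ l} (0<x ∷ ps) = trans (conj-∷-≤ l 0<x) (cong suc (conj-1 ps))

conj-++ : ∀ l m j → conj (l ++ m) j ≡ conj l j + conj m j
conj-++ []      m j = refl
conj-++ (x ∷ l) m j with j ℕ.≤? x
... | yes _ = cong suc (conj-++ l m j)
... | no _  = conj-++ l m j

conj-map-suc : ∀ l j → conj (map suc l) (suc j) ≡ conj l j
conj-map-suc []      j = refl
conj-map-suc (x ∷ l) j with j ℕ.≤? x
... | yes j≤x = trans (conj-∷-≤ (map suc l) (s≤s j≤x)) (cong suc (conj-map-suc l j))
... | no j≰x  = trans (conj-∷-≰ (map suc l) (λ p → j≰x (≤-pred p))) (conj-map-suc l j)

part-≤ : ∀ {m} l i → All (_≤ m) l → part l i ≤ m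
part-≤ []      i             _        = z≤n
part-≤ (x ∷ l) zero          _        = z≤n
part-≤ (x ∷ l) (suc zero)    (x≤m ∷ _) = x≤m
part-≤ (x ∷ l) (suc (suc i)) (_ ∷ ps) = part-≤ l (suc i) ps

part-pos⇒≤length : ∀ l i → 1 ≤ part l i → i ≤ length l
part-pos⇒≤length (x ∷ l) zero          _ = z≤n
part-pos⇒≤length (x ∷ l) (suc zero)    _ = s≤s z≤n
part-pos⇒≤length (x ∷ l) (suc (suc i)) p = s≤s (part-pos⇒≤length l (suc i) p)

≤length⇒part-pos : ∀ {l} i → All (0 <_) l → 1 ≤ i → i ≤ length l → 1 ≤ part l i
≤length⇒part-pos {x ∷ l} (suc zero)    (0<x ∷ _) _ _         = 0<x
≤length⇒part-pos {x ∷ l} (suc (suc i)) (_ ∷ ps)  _ (s≤s i≤) =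
  ≤length⇒part-pos (suc i) ps (s≤s z≤n) i≤

part-++-length : ∀ l m i → part (l ++ m) (length l + suc i) ≡ part m (suc i)
part-++-length []          m i = refl
part-++-length (x ∷ [])    m i = refl
part-++-length (x ∷ y ∷ l) m i = part-++-length (y ∷ l) m i

part-replicate : ∀ {x} k t → t < k → part (replicate k x) (suc t) ≡ x
part-replicate (suc k) zero    _         = refl
part-replicate (suc k) (suc t) (s≤s t<k) = part-replicate k t t<k

part-map-suc-++ : ∀ l m i → 1 ≤ part l i → part (map suc l ++ m) i ≡ suc (part l i)
part-map-suc-++ (x ∷ l) m (suc zero)    _ = refl
part-map-suc-++ (x ∷ l) m (suc (suc i)) p = part-map-suc-++ l m (suc i) p

head-bound : ∀ {x l} → Linked _≥_ (x ∷ l) → All (_≤ x) l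
head-bound lk = AllPairs.head (Linked⇒AllPairs (λ p q → ≤-trans q p) lk)

-- Symplectic contents of the staircase

length-staircase : ∀ r → length (staircase r) ≡ r
length-staircase zero    = refl
length-staircase (suc r) = cong suc (length-staircase r)

length-map-suc-staircase : ∀ r → length (map suc (staircase r)) ≡ r
length-map-suc-staircase r = trans (length-map suc (staircase r)) (length-staircase r)

map-suc-staircase-++ : ∀ r → map suc (staircase r) ++ [ 1 ] ≡ staircase (suc r)
map-suc-staircase-++ zero    = refl
map-suc-staircase-++ (suc r) = cong (suc (suc r) ∷_) (map-suc-staircase-++ r)

staircase-≤ : ∀ r → All (_≤ r) (staircase r)
staircase-≤ zero    = []
staircase-≤ (suc r) = ≤-refl ∷ All.map m≤n⇒m≤1+n (staircase-≤ r)

part-staircase : ∀ r i → 1 ≤ i → i ≤ r → part (staircase r) i + i ≡ suc r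
part-staircase (suc r) (suc zero)    _ _         = +-comm (suc r) 1
part-staircase (suc r) (suc (suc i)) _ (s≤s i≤r) = begin
  part (staircase r) (suc i) + suc (suc i) ≡⟨ +-suc (part (staircase r) (suc i)) (suc i) ⟩
  suc (part (staircase r) (suc i) + suc i) ≡⟨ cong suc (part-staircase r (suc i) (s≤s z≤n) i≤r) ⟩
  suc (suc r)                              ∎
  where open ≡-Reasoning

conj-staircase-> : ∀ r j → r < j → conj (staircase r) j ≡ 0
conj-staircase-> r j r<j = conj-All< (All.map (λ p → ≤-<-trans p r<j) (staircase-≤ r))

conj-staircase : ∀ r j → 1 ≤ j → j ≤ r → conj (staircase r) j + j ≡ suc r
conj-staircase zero    zero    () _
conj-staircase zero    (suc j) _  ()
conj-staircase (suc r) j 1≤j j≤1+r rewrite conj-∷-≤ (staircase r) j≤1+r with j ℕ.≤? r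
... | yes j≤r = cong suc (conj-staircase r j 1≤j j≤r)
... | no j≰r with ≤-antisym j≤1+r (≮⇒≥ (λ j<1+r → j≰r (≤-pred j<1+r)))
...   | refl = cong (λ c → suc (c + suc r)) (conj-staircase-> r (suc r) ≤-refl)

odd≢even : ∀ m n → suc (m + m) ≢ n + n
odd≢even m n eq = even≢odd n m (begin
  2 ℕ.* n        ≡⟨ double n ⟩
  n + n          ≡⟨ sym eq ⟩
  suc (m + m)    ≡⟨ cong suc (sym (double m)) ⟩
  suc (2 ℕ.* m)  ∎)
  where
  open ≡-Reasoning
  double : ∀ k → 2 ℕ.* k ≡ k + k
  double = ℕSolver.solve-∀

even-sum⇒diff≢±1 : ∀ x y z → x + y ≡ z + z → (+ x - + y) ≢±1
even-sum⇒diff≢±1 x y z x+y≡z+z = diff≢1 , diff≢-1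
  where
  add-back : ∀ (u v : ℤ) → u ≡ (u - v) ℤ.+ v
  add-back = ℤSolver.solve-∀
  take-back : ∀ (u v : ℤ) → v ≡ u - (u - v)
  take-back = ℤSolver.solve-∀
  odd-form : ∀ m → suc (m + m) ≡ m + (m + 1)
  odd-form = ℕSolver.solve-∀
  x≡d+y : ∀ (d : ℤ) → + x - + y ≡ d → + x ≡ d ℤ.+ + y
  x≡d+y d eq = trans (add-back (+ x) (+ y)) (cong (ℤ._+ + y) eq)
  diff≢1 : ¬ (+ x - + y ≡ + 1)
  diff≢1 eq with +-injective (x≡d+y (+ 1) eq)
  ... | refl = odd≢even y z x+y≡z+z
  diff≢-1 : ¬ (+ x - + y ≡ -[1+ 0 ])
  diff≢-1 eq with +-injective (trans (take-back (+ x) (+ y)) (cong (+ x -_) eq))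
  ... | refl = odd≢even x z (trans (odd-form x) x+y≡z+z)

staircase-no±1 : ∀ r → NoContent±1 (staircase r)
staircase-no±1 r i j (1≤i , 1≤j , j≤λᵢ) with <-≤-connex j i
... | inj₁ j<i = subst _≢±1 (sym (trans (cSp-< δ j<i) (regroup (+ p) (+ q) (+ i) (+ j))))
                  (even-sum⇒diff≢±1 ((p + 1) + (q + 1)) (i + j) (suc r + 1) sums)
  where
  δ = staircase r
  p = part δ i
  q = part δ j
  i≤r : i ≤ r
  i≤r = subst (i ≤_) (length-staircase r) (part-pos⇒≤length δ i (≤-trans 1≤j j≤λᵢ))
  regroup : ∀ (P Q I J : ℤ) →
            (((P ℤ.+ Q) - I) - J) ℤ.+ + 2 ≡ ((P ℤ.+ + 1) ℤ.+ (Q ℤ.+ + 1)) - (I ℤ.+ J)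
  regroup = ℤSolver.solve-∀
  shuffle : ∀ a b c d → ((a + 1) + (b + 1)) + (c + d) ≡ ((a + c) + 1) + ((b + d) + 1)
  shuffle = ℕSolver.solve-∀
  sums : ((p + 1) + (q + 1)) + (i + j) ≡ (suc r + 1) + (suc r + 1)
  sums = trans (shuffle p q i j)
    (cong₂ (λ u v → (u + 1) + (v + 1))
      (part-staircase r i 1≤i i≤r) (part-staircase r j 1≤j (≤-trans (<⇒≤ j<i) i≤r)))
... | inj₂ i≤j = subst _≢±1 (sym (trans (cSp-≥ δ i≤j) (regroup (+ i) (+ j) (+ c) (+ d))))
                 (even-sum⇒diff≢±1 (i + j) (c + d) (suc r) sums)
  where
  δ = staircase r
  c = conj δ i
  d = conj δ j
  j≤r : j ≤ r
  j≤r = ≤-trans j≤λᵢ (part-≤ δ i (staircase-≤ r))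
  regroup : ∀ (I J C D : ℤ) → ((I ℤ.+ J) - C) - D ≡ (I ℤ.+ J) - (C ℤ.+ D)
  regroup = ℤSolver.solve-∀
  shuffle : ∀ a b c d → (a + b) + (c + d) ≡ (c + a) + (d + b)
  shuffle = ℕSolver.solve-∀
  sums : (i + j) + (c + d) ≡ suc r + suc r
  sums = trans (shuffle i j c d)
    (cong₂ _+_ (conj-staircase r i 1≤i (≤-trans i≤j j≤r)) (conj-staircase r j 1≤j j≤r))

-- Removing the first row and column

-- λ = addHook a μ k has λ₁ = a, leaves μ after deleting its first row and column,
-- and has k rows of length 1 below those of μ.
addHook : ℕ → List ℕ → ℕ → List ℕ
addHook a μ k = a ∷ map suc μ ++ replicate k 1

all-ones : ∀ {l} → All (_≤ 1) l → All (0 <_) l → l ≡ replicate (length l) 1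
all-ones {[]}    []          []          = refl
all-ones {x ∷ l} (x≤1 ∷ ps) (0<x ∷ qs) = cong₂ _∷_ (≤-antisym x≤1 0<x) (all-ones ps qs)

strip-first-column : ∀ {l} → IsPartition l →
       ∃[ μ ] ∃[ k ] (l ≡ map suc μ ++ replicate k 1 × IsPartition μ × length μ ≤ length l)
strip-first-column {[]}              _                = [] , 0 , refl , ([] , []) , z≤n
strip-first-column {zero ∷ l}        (_ , () ∷ _)
strip-first-column {suc zero ∷ l}    (lk , _ ∷ pos)   =
  [] , suc (length l) , cong (1 ∷_) (all-ones (head-bound lk) pos) , ([] , []) , z≤n
strip-first-column {suc (suc y) ∷ l} (lk , _ ∷ pos) with strip-first-column (Linked.tail lk , pos)
... | μ , k , refl , (lkμ , posμ) , len =
  suc y ∷ μ , k , refl , (linked lk lkμ , s≤s z≤n ∷ posμ) , s≤s len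
  where
  linked : ∀ {μ} → Linked _≥_ (suc (suc y) ∷ map suc μ ++ replicate k 1) → Linked _≥_ μ →
           Linked _≥_ (suc y ∷ μ)
  linked {[]}    _        _   = [-]
  linked {_ ∷ _} (p ∷ _) lkμ = ≤-pred p ∷ lkμ

hook-conj : ∀ μ k j → 1 ≤ j → conj (map suc μ ++ replicate k 1) (suc j) ≡ conj μ j
hook-conj μ k j 1≤j = begin
  conj (map suc μ ++ replicate k 1) (suc j)
    ≡⟨ conj-++ (map suc μ) _ (suc j) ⟩
  conj (map suc μ) (suc j) + conj (replicate k 1) (suc j)
    ≡⟨ cong₂ _+_ (conj-map-suc μ j) ones-below ⟩
  conj μ j + 0
    ≡⟨ +-identityʳ (conj μ j) ⟩
  conj μ j ∎
  where
  open ≡-Reasoning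
  ones-below : conj (replicate k 1) (suc j) ≡ 0
  ones-below = conj-All< (replicate⁺ k (s≤s 1≤j))

hook-cell : ∀ {a μ k i j} → Linked _≥_ (addHook a μ k) → All (0 <_) μ → InDiagram μ i j →
            InDiagram (addHook a μ k) (suc i) (suc j) ×
            cSp (addHook a μ k) (suc i) (suc j) ≡ cSp μ i j
hook-cell {i = zero} _ _ (() , _)
hook-cell {j = zero} _ _ (_ , () , _)
hook-cell {a} {μ} {k} {i@(suc _)} {j@(suc _)} lk posμ (_ , _ , j≤μᵢ) =
  (s≤s z≤n , s≤s z≤n , 1+j≤λ₁₊ᵢ) , content
  where
  lam = addHook a μ k
  rest = map suc μ ++ replicate k 1
  1≤μᵢ : 1 ≤ part μ i
  1≤μᵢ = ≤-trans (s≤s z≤n) j≤μᵢ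
  row : ∀ r → 1 ≤ r → 1 ≤ part μ r → part lam (suc r) ≡ suc (part μ r)
  row r@(suc _) _ 1≤μᵣ = part-map-suc-++ μ _ r 1≤μᵣ
  col : ∀ r → 1 ≤ r → suc r ≤ a → conj lam (suc r) ≡ suc (conj μ r)
  col r 1≤r r<a = trans (conj-∷-≤ rest r<a) (cong suc (hook-conj μ k r 1≤r))
  1+j≤λ₁₊ᵢ : suc j ≤ part lam (suc i)
  1+j≤λ₁₊ᵢ = subst (suc j ≤_) (sym (row i (s≤s z≤n) 1≤μᵢ)) (s≤s j≤μᵢ)
  1+j≤a : suc j ≤ a
  1+j≤a = ≤-trans 1+j≤λ₁₊ᵢ (part-≤ rest i (head-bound lk))
  shift-below : ∀ (P Q I J : ℤ) →
    ((((+ 1 ℤ.+ P) ℤ.+ (+ 1 ℤ.+ Q)) - (+ 1 ℤ.+ I)) - (+ 1 ℤ.+ J)) ℤ.+ + 2 ≡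
    (((P ℤ.+ Q) - I) - J) ℤ.+ + 2
  shift-below = ℤSolver.solve-∀
  shift-above : ∀ (I J C D : ℤ) →
    (((+ 1 ℤ.+ I) ℤ.+ (+ 1 ℤ.+ J)) - (+ 1 ℤ.+ C)) - (+ 1 ℤ.+ D) ≡ ((I ℤ.+ J) - C) - D
  shift-above = ℤSolver.solve-∀
  content : cSp lam (suc i) (suc j) ≡ cSp μ i j
  content with <-≤-connex j i
  ... | inj₁ j<i = begin
    cSp lam (suc i) (suc j)
      ≡⟨ cSp-< lam (s≤s j<i) ⟩
    (((+ part lam (suc i) ℤ.+ + part lam (suc j)) - + suc i) - + suc j) ℤ.+ + 2
      ≡⟨ cong₂ (λ u v → (((+ u ℤ.+ + v) - + suc i) - + suc j) ℤ.+ + 2)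
           (row i (s≤s z≤n) 1≤μᵢ) (row j (s≤s z≤n) 1≤μⱼ) ⟩
    (((+ suc (part μ i) ℤ.+ + suc (part μ j)) - + suc i) - + suc j) ℤ.+ + 2
      ≡⟨ shift-below (+ part μ i) (+ part μ j) (+ i) (+ j) ⟩
    (((+ part μ i ℤ.+ + part μ j) - + i) - + j) ℤ.+ + 2
      ≡⟨ cSp-< μ j<i ⟨
    cSp μ i j ∎
    where
    open ≡-Reasoning
    1≤μⱼ : 1 ≤ part μ j
    1≤μⱼ = ≤length⇒part-pos j posμ (s≤s z≤n) (≤-trans (<⇒≤ j<i) (part-pos⇒≤length μ i 1≤μᵢ))
  ... | inj₂ i≤j = begin
    cSp lam (suc i) (suc j)
      ≡⟨ cSp-≥ lam (s≤s i≤j) ⟩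
    ((+ suc i ℤ.+ + suc j) - + conj lam (suc i)) - + conj lam (suc j)
      ≡⟨ cong₂ (λ u v → ((+ suc i ℤ.+ + suc j) - + u) - + v)
           (col i (s≤s z≤n) (≤-trans (s≤s i≤j) 1+j≤a)) (col j (s≤s z≤n) 1+j≤a) ⟩
    ((+ suc i ℤ.+ + suc j) - + suc (conj μ i)) - + suc (conj μ j)
      ≡⟨ shift-above (+ i) (+ j) (+ conj μ i) (+ conj μ j) ⟩
    ((+ i ℤ.+ + j) - + conj μ i) - + conj μ j
      ≡⟨ cSp-≥ μ i≤j ⟨
    cSp μ i j ∎
    where open ≡-Reasoning

hook-no±1 : ∀ {a μ k} → Linked _≥_ (addHook a μ k) → All (0 <_) μ →
            NoContent±1 (addHook a μ k) → NoContent±1 μ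
hook-no±1 lk posμ noλ i j cell with hook-cell lk posμ cell
... | cellλ , content = subst _≢±1 content (noλ (suc i) (suc j) cellλ)

-- Hooks around a staircase

Content±1At : List ℕ → ℕ → ℕ → Set
Content±1At lam i j = InDiagram lam i j × (cSp lam i j ≡ + 1 ⊎ cSp lam i j ≡ -[1+ 0 ])

refute : ∀ {lam} → NoContent±1 lam → ∀ i j → ¬ Content±1At lam i j
refute noλ i j (cell , inj₁ c≡1)  = proj₁ (noλ i j cell) c≡1
refute noλ i j (cell , inj₂ c≡-1) = proj₂ (noλ i j cell) c≡-1

addHook-pos : ∀ a μ k → All (0 <_) (addHook (suc a) μ k)
addHook-pos a μ k = s≤s z≤n ∷ ++⁺ (map⁺ (All.tabulate (λ _ → s≤s z≤n))) (replicate⁺ k ≤-refl)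

length-addHook-staircase : ∀ a s k → length (addHook a (staircase s) k) ≡ suc (s + k)
length-addHook-staircase a s k = cong suc (begin
  length (map suc (staircase s) ++ replicate k 1)
    ≡⟨ length-++ (map suc (staircase s)) ⟩
  length (map suc (staircase s)) + length (replicate k 1)
    ≡⟨ cong₂ _+_ (length-map-suc-staircase s) (length-replicate k) ⟩
  s + k ∎)
  where open ≡-Reasoning

first-row-content : ∀ a s k j → 1 ≤ j → suc j ≤ suc a →
  cSp (addHook (suc a) (staircase s) k) 1 (suc j) ≡ (+ j - + (s + k)) - + conj (staircase s) j
first-row-content a s k j 1≤j j<1+a = begin
  cSp lam 1 (suc j)                                   ≡⟨ cSp-≥ lam (s≤s z≤n) ⟩
  ((+ 1 ℤ.+ + suc j) - + conj lam 1) - + conj lam (suc j)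
    ≡⟨ cong₂ (λ u v → ((+ 1 ℤ.+ + suc j) - + u) - + v) conj-first conj-later ⟩
  ((+ 1 ℤ.+ + suc j) - + suc (s + k)) - + suc (conj (staircase s) j)
    ≡⟨ cancel (+ j) (+ (s + k)) (+ conj (staircase s) j) ⟩
  (+ j - + (s + k)) - + conj (staircase s) j           ∎
  where
  open ≡-Reasoning
  lam = addHook (suc a) (staircase s) k
  conj-first : conj lam 1 ≡ suc (s + k)
  conj-first =
    trans (conj-1 (addHook-pos a (staircase s) k)) (length-addHook-staircase (suc a) s k)
  conj-later : conj lam (suc j) ≡ suc (conj (staircase s) j)
  conj-later = trans (conj-∷-≤ _ j<1+a) (cong suc (hook-conj (staircase s) k j 1≤j))
  cancel : ∀ (J N C : ℤ) →
    ((+ 1 ℤ.+ (+ 1 ℤ.+ J)) - (+ 1 ℤ.+ N)) - (+ 1 ℤ.+ C) ≡ (J - N) - C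
  cancel = ℤSolver.solve-∀

first-row-longer⇒content±1 : ∀ s k t → k < t →
  Content±1At (addHook (suc (s + t)) (staircase s) k) 1 (suc (suc (s + k)))
first-row-longer⇒content±1 s k t k<t = (s≤s z≤n , s≤s z≤n , j<a) , inj₁ (begin
  cSp (addHook (suc (s + t)) (staircase s) k) 1 (suc (suc (s + k)))
    ≡⟨ first-row-content (s + t) s k (suc (s + k)) (s≤s z≤n) j<a ⟩
  (+ suc (s + k) - + (s + k)) - + conj (staircase s) (suc (s + k))
    ≡⟨ cong (λ c → (+ suc (s + k) - + (s + k)) - + c) (conj-staircase-> s _ (s≤s (m≤m+n s k))) ⟩
  (+ suc (s + k) - + (s + k)) - + 0
    ≡⟨ cancel (+ (s + k)) ⟩
  + 1 ∎)
  where
  open ≡-Reasoning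
  j<a : suc (suc (s + k)) ≤ suc (s + t)
  j<a = s≤s (+-monoʳ-< s k<t)
  cancel : ∀ (N : ℤ) → ((+ 1 ℤ.+ N) - N) - + 0 ≡ + 1
  cancel = ℤSolver.solve-∀

first-column-longer⇒content±1 : ∀ s k t → t < k →
  Content±1At (addHook (suc (s + t)) (staircase s) k) (suc (suc (s + t))) 1
first-column-longer⇒content±1 s k t t<k =
  (s≤s z≤n , s≤s z≤n , ≤-reflexive (sym last-row)) , inj₁ (begin
  cSp lam (suc a) 1
    ≡⟨ cSp-< lam (s≤s (s≤s z≤n)) ⟩
  (((+ part lam (suc a) ℤ.+ + a) - + suc a) - + 1) ℤ.+ + 2
    ≡⟨ cong (λ p → (((+ p ℤ.+ + a) - + suc a) - + 1) ℤ.+ + 2) last-row ⟩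
  (((+ 1 ℤ.+ + a) - + suc a) - + 1) ℤ.+ + 2
    ≡⟨ cancel (+ a) ⟩
  + 1 ∎)
  where
  open ≡-Reasoning
  a = suc (s + t)
  lam = addHook a (staircase s) k
  rest = map suc (staircase s) ++ replicate k 1
  length-top : length (map suc (staircase s)) ≡ s
  length-top = length-map-suc-staircase s
  last-row : part lam (suc a) ≡ 1
  last-row = begin
    part rest (suc (s + t))
      ≡⟨ cong (part rest) (trans (sym (+-suc s t)) (cong (_+ suc t) (sym length-top))) ⟩
    part rest (length (map suc (staircase s)) + suc t)
      ≡⟨ part-++-length (map suc (staircase s)) _ t ⟩
    part (replicate k 1) (suc t)
      ≡⟨ part-replicate k t t<k ⟩
    1 ∎
  cancel : ∀ (A : ℤ) → (((+ 1 ℤ.+ A) - (+ 1 ℤ.+ A)) - + 1) ℤ.+ + 2 ≡ + 1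
  cancel = ℤSolver.solve-∀

balanced-hook⇒staircase : ∀ s k → NoContent±1 (addHook (suc (s + k)) (staircase s) k) →
                ∃[ r ] addHook (suc (s + k)) (staircase s) k ≡ staircase r
balanced-hook⇒staircase zero          zero          _   = 1 , refl
balanced-hook⇒staircase s             (suc zero)    _   =
  suc (suc s) , cong₂ _∷_ (cong suc (+-comm s 1)) (map-suc-staircase-++ s)
balanced-hook⇒staircase s@(suc s′)    zero          noλ =
  ⊥-elim (refute noλ 1 (suc s) ((s≤s z≤n , s≤s z≤n , s≤s s≤s+0) , inj₂ (begin
    cSp (addHook (suc (s + 0)) (staircase s) 0) 1 (suc s)
      ≡⟨ first-row-content (s + 0) s 0 s (s≤s z≤n) (s≤s s≤s+0) ⟩
    (+ s - + (s + 0)) - + conj (staircase s) s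
      ≡⟨ cong (λ c → (+ s - + (s + 0)) - + c) conj-staircase-last ⟩
    (+ s - + (s + 0)) - + 1
      ≡⟨ cancel (+ s) ⟩
    -[1+ 0 ] ∎)))
  where
  open ≡-Reasoning
  s≤s+0 : s ≤ s + 0
  s≤s+0 = m≤m+n s 0
  conj-staircase-last : conj (staircase s) s ≡ 1
  conj-staircase-last = +-cancelʳ-≡ s _ 1 (conj-staircase s s (s≤s z≤n) ≤-refl)
  cancel : ∀ (S : ℤ) → (S - (S ℤ.+ + 0)) - + 1 ≡ ℤ.- + 1
  cancel = ℤSolver.solve-∀
balanced-hook⇒staircase s             k@(suc (suc k′)) noλ =
  ⊥-elim (refute noλ 1 (suc j) ((s≤s z≤n , s≤s z≤n , 1+j≤a) , inj₂ (begin
    cSp (addHook (suc (s + k)) (staircase s) k) 1 (suc j)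
      ≡⟨ first-row-content (s + k) s k j (≤-trans (s≤s z≤n) s<j) 1+j≤a ⟩
    (+ j - + (s + k)) - + conj (staircase s) j
      ≡⟨ cong₂ (λ n c → (+ j - + n) - + c) s+k≡1+j (conj-staircase-> s j s<j) ⟩
    (+ j - + suc j) - + 0
      ≡⟨ cancel (+ j) ⟩
    -[1+ 0 ] ∎)))
  where
  open ≡-Reasoning
  j = s + suc k′
  s<j : s < j
  s<j = m<m+n s (s≤s z≤n)
  s+k≡1+j : s + k ≡ suc j
  s+k≡1+j = +-suc s (suc k′)
  1+j≤a : suc j ≤ suc (s + k)
  1+j≤a = m≤n⇒m≤1+n (≤-reflexive (sym s+k≡1+j))
  cancel : ∀ (J : ℤ) → (J - (+ 1 ℤ.+ J)) - + 0 ≡ ℤ.- + 1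
  cancel = ℤSolver.solve-∀

first-row-exceeds-staircase : ∀ a s k → IsPartition (addHook a (staircase s) k) → suc s ≤ a
first-row-exceeds-staircase a zero     k (_ , 0<a ∷ _) = 0<a
first-row-exceeds-staircase a (suc s) k (lk , _)       = All.head (head-bound lk)

hook-around-staircase : ∀ a s k → IsPartition (addHook a (staircase s) k) →
                        NoContent±1 (addHook a (staircase s) k) →
                        ∃[ r ] addHook a (staircase s) k ≡ staircase r
hook-around-staircase a s k p noλ with m≤n⇒∃[o]m+o≡n (first-row-exceeds-staircase a s k p)
... | t , refl with <-cmp t k
...   | tri< t<k _ _  = ⊥-elim (refute noλ _ _ (first-column-longer⇒content±1 s k t t<k))
...   | tri≈ _ refl _ = balanced-hook⇒staircase s t noλ
...   | tri> _ _ k<t  = ⊥-elim (refute noλ _ _ (first-row-longer⇒content±1 s k t k<t))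

no±1⇒staircase : ∀ n lam → length lam ≤ n → IsPartition lam → NoContent±1 lam →
                 ∃[ r ] lam ≡ staircase r
no±1⇒staircase _       []      _         _          _   = 0 , refl
no±1⇒staircase (suc n) (a ∷ l) (s≤s len) (lk , pos) noλ
  with strip-first-column (Linked.tail lk , All.tail pos)
... | μ , k , refl , (lkμ , posμ) , lenμ
  with no±1⇒staircase n μ (≤-trans lenμ len) (lkμ , posμ) (hook-no±1 lk posμ noλ)
...   | s , refl = hook-around-staircase a s k (lk , pos) noλ

theorem2p13 : (lam : List ℕ) → IsPartition lam →
    ((∀ i j → InDiagram lam i j → ¬ (cSp lam i j ≡ + 1) × ¬ (cSp lam i j ≡ -[1+ 0 ]))
      → (lam ≡ [] ⊎ ∃[ r ] (1 ≤ r × lam ≡ staircase r)))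
    × ((lam ≡ [] ⊎ ∃[ r ] (1 ≤ r × lam ≡ staircase r))
      → (∀ i j → InDiagram lam i j → ¬ (cSp lam i j ≡ + 1) × ¬ (cSp lam i j ≡ -[1+ 0 ])))
theorem2p13 lam p = forward , backward
  where
  forward : NoContent±1 lam → lam ≡ [] ⊎ ∃[ r ] (1 ≤ r × lam ≡ staircase r)
  forward noλ with no±1⇒staircase (length lam) lam ≤-refl p noλ
  ... | zero  , refl = inj₁ refl
  ... | suc r , refl = inj₂ (suc r , s≤s z≤n , refl)
  backward : lam ≡ [] ⊎ ∃[ r ] (1 ≤ r × lam ≡ staircase r) → NoContent±1 lam
  backward (inj₁ refl)           = staircase-no±1 0
  backward (inj₂ (r , _ , refl)) = staircase-no±1 r
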